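{- Let $G$ be a cubic brick, let $x$ be a vertex of $G$, and let $G^{\triangle}$ be obtained from $G$ by a $Y\rightarrow\triangle$-operation on $x$. If $e$ is an edge of $G$ that is not a forcing edge of $G$, then the edge $e'$ of $G^{\triangle}$ corresponding to $e$ is not a forcing edge of $G^{\triangle}$.
   Context: A $Y\rightarrow\triangle$-operation on a vertex $x$ with neighbours $y_1,y_2,y_3$ replaces $x$ by a triangle $x_1x_2x_3x_1$ and joins $x_i$ to $y_i$ ($i=1,2,3$). The edge of $G^{\triangle}$ corresponding to $xy_i$ is $x_iy_i$; an edge of $G$ not incident with $x$ corresponds to itself in $G^{\triangle}$. An edge $e$ of a graph $G$ is forcing (solitary) if $G-V(e)$ has a unique perfect matching, i.e. $e$ lies in exactly one perfect matching of $G$. A brick is a 3-connected bicritical graph. -}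

module Defs where

open import Data.Nat using (ℕ; _≤_)
open import Data.Fin using (Fin; zero; suc; _≟_)
open import Data.Bool using (Bool; true; false; if_then_else_; _∨_)
open import Data.List using (List; length; map; allFin)
open import Data.Nat.ListAction using (sum)
open import Data.List.Membership.Propositional using (_∉_)
open import Data.Product using (Σ; ∃; _×_)
open import Relation.Binary.PropositionalEquality using (_≡_; _≢_)
open import Relation.Nullary.Decidable using (⌊_⌋)

Graph : ℕ → Set
Graph n = Fin n → Fin n → Bool

IsSimple : ∀ {n} → Graph n → Set
IsSimple {n} G = (∀ (u v : Fin n) → G u v ≡ G v u) × (∀ (v : Fin n) → G v v ≡ false)

degree : ∀ {n} → Graph n → Fin n → ℕ
degree {n} G v = sum (map (λ w → if G v w then 1 else 0) (allFin n))

Cubic : ∀ {n} → Graph n → Set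
Cubic {n} G = ∀ (v : Fin n) → degree G v ≡ 3

-- A perfect matching of the subgraph of G induced by the vertex set S,
-- represented by its partner function (only its values on S matter).
record PerfectMatching {n} (G : Graph n) (S : Fin n → Set) : Set where
  field
    partner : Fin n → Fin n
    partner-in  : ∀ v → S v → S (partner v)
    partner-adj : ∀ v → S v → G v (partner v) ≡ true
    partner-inv : ∀ v → S v → partner (partner v) ≡ v
open PerfectMatching public

-- The induced subgraph on S has a unique perfect matching
-- (two perfect matchings are equal iff their partner functions agree on S).
UniquePM : ∀ {n} → Graph n → (Fin n → Set) → Set
UniquePM {n} G S = Σ (PerfectMatching G S) λ M →
  ∀ (M' : PerfectMatching G S) → ∀ v → S v → partner M v ≡ partner M' v

Minus2 : ∀ {n} → Fin n → Fin n → Fin n → Set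
Minus2 u v w = (w ≢ u) × (w ≢ v)

Forcing : ∀ {n} → Graph n → Fin n → Fin n → Set
Forcing G u v = UniquePM G (Minus2 u v)

data Walk {n} (G : Graph n) (S : Fin n → Set) : Fin n → Fin n → Set where
  here : ∀ {u} → Walk G S u u
  step : ∀ {u v w} → S v → G u v ≡ true → Walk G S v w → Walk G S u w

Connected : ∀ {n} → Graph n → (Fin n → Set) → Set
Connected {n} G S = ∀ (u v : Fin n) → S u → S v → Walk G S u v

ThreeConnected : ∀ {n} → Graph n → Set
ThreeConnected {n} G =
  (4 ≤ n) × (∀ (X : List (Fin n)) → length X ≤ 2 → Connected G (λ w → w ∉ X))

Bicritical : ∀ {n} → Graph n → Set
Bicritical {n} G = ∀ (u v : Fin n) → u ≢ v → PerfectMatching G (Minus2 u v)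

Brick : ∀ {n} → Graph n → Set
Brick G = ThreeConnected G × Bicritical G

NeighbourList : ∀ {n} → Graph n → Fin n → (Fin 3 → Fin n) → Set
NeighbourList {n} G x y =
  (∀ i j → y i ≡ y j → i ≡ j) × (∀ i → G x (y i) ≡ true) ×
  (∀ (w : Fin n) → G x w ≡ true → ∃ λ i → y i ≡ w)

-- Y→Δ on x.  Vertex set of G^Δ is Fin (2 + n): old vertex w ↦ lift w
-- (so x₁ = lift x sits where x was), x₂ = zero, x₃ = suc zero.
lift : ∀ {n} → Fin n → Fin (2 Data.Nat.+ n)
lift w = suc (suc w)

tri : ∀ {n} → Fin n → Fin 3 → Fin (2 Data.Nat.+ n)
tri x zero = lift x
tri x (suc zero) = zero
tri x (suc (suc zero)) = suc zero

_==_ : ∀ {n} → Fin n → Fin n → Bool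
a == b = ⌊ a ≟ b ⌋

YΔ : ∀ {n} → Graph n → Fin n → (Fin 3 → Fin n) → Graph (2 Data.Nat.+ n)
YΔ G x y zero zero = false
YΔ G x y zero (suc zero) = true
YΔ G x y zero (suc (suc v)) = (v == x) ∨ (v == y (suc zero))
YΔ G x y (suc zero) zero = true
YΔ G x y (suc zero) (suc zero) = false
YΔ G x y (suc zero) (suc (suc v)) = (v == x) ∨ (v == y (suc (suc zero)))
YΔ G x y (suc (suc u)) zero = (u == x) ∨ (u == y (suc zero))
YΔ G x y (suc (suc u)) (suc zero) = (u == x) ∨ (u == y (suc (suc zero)))
YΔ G x y (suc (suc u)) (suc (suc v)) =
  if u == x then v == y zero else (if v == x then u == y zero else G u v)

-- Image of endpoint w of the edge w o of G in the corresponding edge of G^Δ: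
-- if w = x and o = yᵢ then xᵢ, otherwise w itself.
endpoint : ∀ {n} → Fin n → (Fin 3 → Fin n) → Fin n → Fin n → Fin (2 Data.Nat.+ n)
endpoint x y w o =
  if w == x
  then (if o == y zero then tri x zero
        else (if o == y (suc zero) then tri x (suc zero) else tri x (suc (suc zero))))
  else lift w

{-# OPTIONS --safe #-}
-- Every perfect matching M of G - u - v extends to one of GΔ - u′ - v′: if x is matched to y_i
-- (or uv is the edge x y_i), use x_i y_i, join the other two triangle vertices and keep the rest
-- of M. Contracting the triangle gives M back away from x, so if GΔ - u′ - v′ has only one perfect
-- matching, any two perfect matchings of G - u - v agree away from x, and then also at x.
module Submission where

open import Defs
open import Data.Nat using (ℕ; _+_)
open import Data.Fin using (Fin; zero; suc; _≟_)
open import Data.Fin.Patterns using (0F; 1F; 2F)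
open import Data.Bool using (true; false)
open import Data.Bool.Properties using (∨-zeroʳ)
open import Data.Product using (Σ; _,_; proj₁; proj₂)
open import Relation.Nullary using (¬_; Dec; yes; no; contradiction)
open import Relation.Nullary.Decidable using (isYes≗does; dec-true; dec-false)
open import Relation.Binary.PropositionalEquality
  using (_≡_; _≢_; refl; sym; trans; cong; subst; subst₂; module ≡-Reasoning)

==-true : ∀ {n} {a b : Fin n} → a ≡ b → (a == b) ≡ true
==-true {a = a} {b} a≡b = trans (isYes≗does (a ≟ b)) (dec-true (a ≟ b) a≡b)

==-false : ∀ {n} {a b : Fin n} → a ≢ b → (a == b) ≡ false
==-false {a = a} {b} a≢b = trans (isYes≗does (a ≟ b)) (dec-false (a ≟ b) a≢b)

-- For j ≢ r, the element of Fin 3 distinct from both; the diagonal values are junk.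
third : Fin 3 → Fin 3 → Fin 3
third 0F 1F = 2F
third 0F 2F = 1F
third 1F 0F = 2F
third 1F 2F = 0F
third 2F 0F = 1F
third 2F 1F = 0F
third j _ = j

third-≢ˡ : ∀ {j r} → j ≢ r → j ≢ third j r
third-≢ˡ {0F} {0F} j≢r = contradiction refl j≢r
third-≢ˡ {0F} {1F} _ = λ ()
third-≢ˡ {0F} {2F} _ = λ ()
third-≢ˡ {1F} {0F} _ = λ ()
third-≢ˡ {1F} {1F} j≢r = contradiction refl j≢r
third-≢ˡ {1F} {2F} _ = λ ()
third-≢ˡ {2F} {0F} _ = λ ()
third-≢ˡ {2F} {1F} _ = λ ()
third-≢ˡ {2F} {2F} j≢r = contradiction refl j≢r

third-≢ʳ : ∀ {j r} → j ≢ r → third j r ≢ r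
third-≢ʳ {0F} {0F} j≢r = contradiction refl j≢r
third-≢ʳ {0F} {1F} _ = λ ()
third-≢ʳ {0F} {2F} _ = λ ()
third-≢ʳ {1F} {0F} _ = λ ()
third-≢ʳ {1F} {1F} j≢r = contradiction refl j≢r
third-≢ʳ {1F} {2F} _ = λ ()
third-≢ʳ {2F} {0F} _ = λ ()
third-≢ʳ {2F} {1F} _ = λ ()
third-≢ʳ {2F} {2F} j≢r = contradiction refl j≢r

third-involutive : ∀ {j r} → j ≢ r → third (third j r) r ≡ j
third-involutive {0F} {0F} j≢r = contradiction refl j≢r
third-involutive {0F} {1F} _ = refl
third-involutive {0F} {2F} _ = refl
third-involutive {1F} {0F} _ = refl
third-involutive {1F} {1F} j≢r = contradiction refl j≢r
third-involutive {1F} {2F} _ = refl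
third-involutive {2F} {0F} _ = refl
third-involutive {2F} {1F} _ = refl
third-involutive {2F} {2F} j≢r = contradiction refl j≢r

module YΔ-Properties {n : ℕ} (G : Graph n) (simple : IsSimple G)
                     (x : Fin n) (y : Fin 3 → Fin n) (nl : NeighbourList G x y) where

  GΔ : Graph (2 + n)
  GΔ = YΔ G x y

  y-injective : ∀ {i j} → y i ≡ y j → i ≡ j
  y-injective = proj₁ nl _ _

  neighbour-index : ∀ {w} → G x w ≡ true → Σ (Fin 3) λ i → y i ≡ w
  neighbour-index = proj₂ (proj₂ nl) _

  loopless : ∀ {w} → ¬ G w w ≡ true
  loopless {w} ww with () ← trans (sym (proj₂ simple w)) ww

  y≢x : ∀ j → y j ≢ x
  y≢x j yj≡x = loopless (subst (λ w → G x w ≡ true) yj≡x (proj₁ (proj₂ nl) j))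

  x==x : (x == x) ≡ true
  x==x = ==-true refl

  contract : Fin (2 + n) → Fin n
  contract zero = x
  contract (suc zero) = x
  contract (suc (suc w)) = w

  contract-tri : ∀ j → contract (tri x j) ≡ x
  contract-tri 0F = refl
  contract-tri 1F = refl
  contract-tri 2F = refl

  lift≢tri : ∀ {w} j → w ≢ x → lift w ≢ tri x j
  lift≢tri j w≢x e = w≢x (trans (cong contract e) (contract-tri j))

  tri-injective : ∀ {j k} → tri x j ≡ tri x k → j ≡ k
  tri-injective {0F} {0F} _ = refl
  tri-injective {0F} {1F} ()
  tri-injective {0F} {2F} ()
  tri-injective {1F} {0F} ()
  tri-injective {1F} {1F} _ = refl
  tri-injective {1F} {2F} ()
  tri-injective {2F} {0F} ()
  tri-injective {2F} {1F} ()
  tri-injective {2F} {2F} _ = refl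

  -- endpoint x y w (y r) is liftAt r w: the edge x y_r of G corresponds to x_r y_r.
  liftAt : Fin 3 → Fin n → Fin (2 + n)
  liftAt r w with w ≟ x
  ... | yes _ = tri x r
  ... | no _ = lift w

  liftAt-x : ∀ {r} → liftAt r x ≡ tri x r
  liftAt-x with x ≟ x
  ... | yes _ = refl
  ... | no x≢x = contradiction refl x≢x

  liftAt-≢ : ∀ {r w} → w ≢ x → liftAt r w ≡ lift w
  liftAt-≢ {w = w} w≢x with w ≟ x
  ... | yes w≡x = contradiction w≡x w≢x
  ... | no _ = refl

  contract-liftAt : ∀ {r} w → contract (liftAt r w) ≡ w
  contract-liftAt {r} w with w ≟ x
  ... | yes w≡x = trans (contract-tri r) (sym w≡x)
  ... | no _ = refl

  liftAt-injective : ∀ {r w w′} → liftAt r w ≡ liftAt r w′ → w ≡ w′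
  liftAt-injective {w = w} {w′} e =
    trans (sym (contract-liftAt w)) (trans (cong contract e) (contract-liftAt w′))

  tri≢liftAt : ∀ {j r} w → j ≢ r → tri x j ≢ liftAt r w
  tri≢liftAt w j≢r with w ≟ x
  ... | yes _ = λ e → j≢r (tri-injective e)
  ... | no w≢x = λ e → lift≢tri _ w≢x (sym e)

  endpoint-≢ : ∀ {u} o → u ≢ x → endpoint x y u o ≡ lift u
  endpoint-≢ o u≢x rewrite ==-false u≢x = refl

  endpoint-x : ∀ i → endpoint x y x (y i) ≡ tri x i
  endpoint-x 0F rewrite x==x | ==-true {a = y 0F} refl = refl
  endpoint-x 1F rewrite x==x | ==-false {a = y 1F} {y 0F} (λ e → contradiction (y-injective e) λ ())
                       | ==-true {a = y 1F} refl = refl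
  endpoint-x 2F rewrite x==x | ==-false {a = y 2F} {y 0F} (λ e → contradiction (y-injective e) λ ())
                       | ==-false {a = y 2F} {y 1F} (λ e → contradiction (y-injective e) λ ()) = refl

  contract-endpoint : ∀ u o → contract (endpoint x y u o) ≡ u
  contract-endpoint u o with u ≟ x
  ... | no _ = refl
  ... | yes refl with o == y 0F | o == y 1F
  ...   | true | _ = refl
  ...   | false | true = refl
  ...   | false | false = refl

  GΔ-lift-lift : ∀ {a b} → a ≢ x → b ≢ x → G a b ≡ true → GΔ (lift a) (lift b) ≡ true
  GΔ-lift-lift a≢x b≢x ab rewrite ==-false a≢x | ==-false b≢x = ab

  GΔ-tri-lift : ∀ j → GΔ (tri x j) (lift (y j)) ≡ true
  GΔ-tri-lift 0F rewrite x==x | ==-true {a = y 0F} refl = refl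
  GΔ-tri-lift 1F rewrite ==-true {a = y 1F} refl = ∨-zeroʳ _
  GΔ-tri-lift 2F rewrite ==-true {a = y 2F} refl = ∨-zeroʳ _

  GΔ-lift-tri : ∀ j → GΔ (lift (y j)) (tri x j) ≡ true
  GΔ-lift-tri 0F rewrite ==-false (y≢x 0F) | x==x | ==-true {a = y 0F} refl = refl
  GΔ-lift-tri 1F rewrite ==-true {a = y 1F} refl = ∨-zeroʳ _
  GΔ-lift-tri 2F rewrite ==-true {a = y 2F} refl = ∨-zeroʳ _

  GΔ-tri-tri : ∀ {j k} → j ≢ k → GΔ (tri x j) (tri x k) ≡ true
  GΔ-tri-tri {0F} {0F} j≢k = contradiction refl j≢k
  GΔ-tri-tri {0F} {1F} _ rewrite x==x = refl
  GΔ-tri-tri {0F} {2F} _ rewrite x==x = refl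
  GΔ-tri-tri {1F} {0F} _ rewrite x==x = refl
  GΔ-tri-tri {1F} {1F} j≢k = contradiction refl j≢k
  GΔ-tri-tri {1F} {2F} _ = refl
  GΔ-tri-tri {2F} {0F} _ rewrite x==x = refl
  GΔ-tri-tri {2F} {1F} _ = refl
  GΔ-tri-tri {2F} {2F} j≢k = contradiction refl j≢k

  GΔ-liftAt : ∀ {r a b} → G a b ≡ true → (a ≡ x → b ≡ y r) → (b ≡ x → a ≡ y r) →
              GΔ (liftAt r a) (liftAt r b) ≡ true
  GΔ-liftAt {r} {a} {b} ab a-x b-x with a ≟ x | b ≟ x
  ... | yes refl | yes refl = contradiction (sym (a-x refl)) (y≢x r)
  ... | yes refl | no _ = subst (λ b → GΔ (tri x r) (lift b) ≡ true) (sym (a-x refl)) (GΔ-tri-lift r)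
  ... | no _ | yes refl = subst (λ a → GΔ (lift a) (tri x r) ≡ true) (sym (b-x refl)) (GΔ-lift-tri r)
  ... | no a≢x | no b≢x = GΔ-lift-lift a≢x b≢x ab

  data Vertex (r : Fin 3) : Fin (2 + n) → Set where
    old : ∀ w → Vertex r (liftAt r w)
    new : ∀ {j} → j ≢ r → Vertex r (tri x j)

  vertex-tri : ∀ r j → Vertex r (tri x j)
  vertex-tri r j with j ≟ r
  ... | yes refl = subst (Vertex r) liftAt-x (old x)
  ... | no j≢r = new j≢r

  vertex : ∀ r a → Vertex r a
  vertex r zero = vertex-tri r 1F
  vertex r (suc zero) = vertex-tri r 2F
  vertex r (suc (suc w)) with w ≟ x
  ... | yes refl = vertex-tri r 0F
  ... | no w≢x = subst (Vertex r) (liftAt-≢ w≢x) (old w)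

  Extends : ∀ {S S′} → PerfectMatching G S → PerfectMatching GΔ S′ → Set
  Extends {S} M N = ∀ w → S w → w ≢ x → contract (partner N (lift w)) ≡ partner M w

  module Extension (r : Fin 3) {S : Fin n → Set} {S′ : Fin (2 + n) → Set}
                   (liftAt-S : ∀ {w} → S w → S′ (liftAt r w))
                   (liftAt-S⁻¹ : ∀ {w} → S′ (liftAt r w) → S w)
                   (tri-S′ : ∀ {j} → j ≢ r → S′ (tri x j))
                   (M : PerfectMatching G S) (M-x : S x → partner M x ≡ y r) where

    p : Fin n → Fin n
    p = partner M

    triPartner : Fin 3 → Fin (2 + n)
    triPartner j with j ≟ r
    ... | yes _ = liftAt r (p x)
    ... | no _ = tri x (third j r)

    partner′ : Fin (2 + n) → Fin (2 + n)
    partner′ zero = triPartner 1F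
    partner′ (suc zero) = triPartner 2F
    partner′ (suc (suc w)) with w ≟ x
    ... | yes _ = triPartner 0F
    ... | no _ = liftAt r (p w)

    partner′-tri : ∀ j → partner′ (tri x j) ≡ triPartner j
    partner′-tri 0F with x ≟ x
    ... | yes _ = refl
    ... | no x≢x = contradiction refl x≢x
    partner′-tri 1F = refl
    partner′-tri 2F = refl

    triPartner-r : triPartner r ≡ liftAt r (p x)
    triPartner-r with r ≟ r
    ... | yes _ = refl
    ... | no r≢r = contradiction refl r≢r

    triPartner-≢ : ∀ {j} → j ≢ r → triPartner j ≡ tri x (third j r)
    triPartner-≢ {j} j≢r with j ≟ r
    ... | yes j≡r = contradiction j≡r j≢r
    ... | no _ = refl

    partner′-lift : ∀ {w} → w ≢ x → partner′ (lift w) ≡ liftAt r (p w)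
    partner′-lift {w} w≢x with w ≟ x
    ... | yes w≡x = contradiction w≡x w≢x
    ... | no _ = refl

    partner′-new : ∀ {j} → j ≢ r → partner′ (tri x j) ≡ tri x (third j r)
    partner′-new {j} j≢r = trans (partner′-tri j) (triPartner-≢ j≢r)

    partner′-liftAt : ∀ w → partner′ (liftAt r w) ≡ liftAt r (p w)
    partner′-liftAt w with w ≟ x
    ... | yes refl = trans (partner′-tri r) triPartner-r
    ... | no w≢x = partner′-lift w≢x

    partner-x : ∀ {w} → S w → w ≡ x → p w ≡ y r
    partner-x Sw refl = M-x Sw

    partner-to-x : ∀ {w} → S w → p w ≡ x → w ≡ y r
    partner-to-x {w} Sw pw≡x = trans (sym (partner-inv M w Sw)) (partner-x (partner-in M w Sw) pw≡x)

    partner′-in : ∀ a → S′ a → S′ (partner′ a)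
    partner′-in a S′a with vertex r a
    ... | old w rewrite partner′-liftAt w = liftAt-S (partner-in M w (liftAt-S⁻¹ S′a))
    ... | new j≢r rewrite partner′-new j≢r = tri-S′ (third-≢ʳ j≢r)

    partner′-adj : ∀ a → S′ a → GΔ a (partner′ a) ≡ true
    partner′-adj a S′a with vertex r a
    ... | old w rewrite partner′-liftAt w =
      GΔ-liftAt (partner-adj M w Sw) (partner-x Sw) (partner-to-x Sw)
      where Sw = liftAt-S⁻¹ S′a
    ... | new j≢r rewrite partner′-new j≢r = GΔ-tri-tri (third-≢ˡ j≢r)

    partner′-inv : ∀ a → S′ a → partner′ (partner′ a) ≡ a
    partner′-inv a S′a with vertex r a
    ... | old w = begin
      partner′ (partner′ (liftAt r w)) ≡⟨ cong partner′ (partner′-liftAt w) ⟩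
      partner′ (liftAt r (p w))        ≡⟨ partner′-liftAt (p w) ⟩
      liftAt r (p (p w))               ≡⟨ cong (liftAt r) (partner-inv M w (liftAt-S⁻¹ S′a)) ⟩
      liftAt r w                       ∎
      where open ≡-Reasoning
    ... | new {j} j≢r = begin
      partner′ (partner′ (tri x j))    ≡⟨ cong partner′ (partner′-new j≢r) ⟩
      partner′ (tri x (third j r))     ≡⟨ partner′-new (third-≢ʳ j≢r) ⟩
      tri x (third (third j r) r)      ≡⟨ cong (tri x) (third-involutive j≢r) ⟩
      tri x j                          ∎
      where open ≡-Reasoning

    extension : PerfectMatching GΔ S′
    extension = record
      { partner = partner′ ; partner-in = partner′-in ; partner-adj = partner′-adj ; partner-inv = partner′-inv }

    extension-extends : Extends M extension
    extension-extends w _ w≢x = begin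
      contract (partner′ (lift w)) ≡⟨ cong contract (partner′-lift w≢x) ⟩
      contract (liftAt r (p w))    ≡⟨ contract-liftAt (p w) ⟩
      p w                          ∎
      where open ≡-Reasoning

  ExtensionOf : ∀ {S} → PerfectMatching G S → Fin (2 + n) → Fin (2 + n) → Set
  ExtensionOf M a b = Σ (PerfectMatching GΔ (Minus2 a b)) (Extends M)

  Minus2-extension : ∀ r {u v} (M : PerfectMatching G (Minus2 u v)) →
                     (Minus2 u v x → partner M x ≡ y r) → ExtensionOf M (liftAt r u) (liftAt r v)
  Minus2-extension r {u} {v} M M-x = extension , extension-extends
    where
    liftAt-S : ∀ {w} → Minus2 u v w → Minus2 (liftAt r u) (liftAt r v) (liftAt r w)
    liftAt-S (w≢u , w≢v) = (λ e → w≢u (liftAt-injective e)) , (λ e → w≢v (liftAt-injective e))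

    liftAt-S⁻¹ : ∀ {w} → Minus2 (liftAt r u) (liftAt r v) (liftAt r w) → Minus2 u v w
    liftAt-S⁻¹ (w≢u , w≢v) = (λ e → w≢u (cong (liftAt r) e)) , (λ e → w≢v (cong (liftAt r) e))

    tri-S′ : ∀ {j} → j ≢ r → Minus2 (liftAt r u) (liftAt r v) (tri x j)
    tri-S′ j≢r = tri≢liftAt u j≢r , tri≢liftAt v j≢r

    open Extension r {S′ = Minus2 (liftAt r u) (liftAt r v)} liftAt-S liftAt-S⁻¹ tri-S′ M M-x

  liftAt≡endpoint : ∀ {u} r o → u ≢ x → liftAt r u ≡ endpoint x y u o
  liftAt≡endpoint r o u≢x = trans (liftAt-≢ u≢x) (sym (endpoint-≢ o u≢x))

  liftAt-x≡endpoint : ∀ i → liftAt i x ≡ endpoint x y x (y i)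
  liftAt-x≡endpoint i = trans liftAt-x (sym (endpoint-x i))

  extension-at-xˡ : ∀ {u v} → u ≡ x → G u v ≡ true → (M : PerfectMatching G (Minus2 u v)) →
                    ExtensionOf M (endpoint x y u v) (endpoint x y v u)
  extension-at-xˡ {.x} refl xv M with neighbour-index xv
  ... | i , refl = subst₂ (ExtensionOf M) (liftAt-x≡endpoint i) (liftAt≡endpoint i x (y≢x i))
                     (Minus2-extension i M λ S-x → contradiction refl (proj₁ S-x))

  extension-at-xʳ : ∀ {u v} → v ≡ x → G u v ≡ true → (M : PerfectMatching G (Minus2 u v)) →
                    ExtensionOf M (endpoint x y u v) (endpoint x y v u)
  extension-at-xʳ {u} {.x} refl ux M with neighbour-index (trans (proj₁ simple x u) ux)
  ... | i , refl = subst₂ (ExtensionOf M) (liftAt≡endpoint i x (y≢x i)) (liftAt-x≡endpoint i)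
                     (Minus2-extension i M λ S-x → contradiction refl (proj₂ S-x))

  -- x is matched by M to some y_i, and x_i takes over that edge.
  extension-off-x : ∀ {u v} → u ≢ x → v ≢ x → (M : PerfectMatching G (Minus2 u v)) →
                    ExtensionOf M (endpoint x y u v) (endpoint x y v u)
  extension-off-x {u} {v} u≢x v≢x M
    with neighbour-index (partner-adj M x ((λ e → u≢x (sym e)) , (λ e → v≢x (sym e))))
  ... | i , yi≡px = subst₂ (ExtensionOf M) (liftAt≡endpoint i v u≢x) (liftAt≡endpoint i u v≢x)
                      (Minus2-extension i M λ _ → sym yi≡px)

  edge-extension : ∀ {u v} → G u v ≡ true → (M : PerfectMatching G (Minus2 u v)) →
                   ExtensionOf M (endpoint x y u v) (endpoint x y v u)
  edge-extension {u} {v} uv M = by-cases (u ≟ x) (v ≟ x)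
    where
    by-cases : Dec (u ≡ x) → Dec (v ≡ x) → ExtensionOf M (endpoint x y u v) (endpoint x y v u)
    by-cases (yes u≡x) _ = extension-at-xˡ u≡x uv M
    by-cases (no _) (yes v≡x) = extension-at-xʳ v≡x uv M
    by-cases (no u≢x) (no v≢x) = extension-off-x u≢x v≢x M

  Minus2-lift : ∀ {u v w} → Minus2 u v w → Minus2 (endpoint x y u v) (endpoint x y v u) (lift w)
  Minus2-lift {u} {v} (w≢u , w≢v) = lift≢endpoint {o = v} w≢u , lift≢endpoint {o = u} w≢v
    where
    lift≢endpoint : ∀ {w u o} → w ≢ u → lift w ≢ endpoint x y u o
    lift≢endpoint {u = u} {o} w≢u e = w≢u (trans (cong contract e) (contract-endpoint u o))

  partner-≢ : ∀ {S} (M : PerfectMatching G S) {w} → S w → partner M w ≢ w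
  partner-≢ M {w} Sw e = loopless (subst (λ v → G w v ≡ true) e (partner-adj M w Sw))

  -- Off x, any two matchings of G[S] are read off the unique matching of GΔ[S′];
  -- at x, the common partner q of x is matched back to x by both, so M x = q as well.
  extensions-reflect-UniquePM : ∀ {S S′} → (∀ {w} → S w → S′ (lift w)) →
                                ((M : PerfectMatching G S) → Σ (PerfectMatching GΔ S′) (Extends M)) →
                                PerfectMatching G S → UniquePM GΔ S′ → UniquePM G S
  extensions-reflect-UniquePM {S} lift-S′ extend M₀ (_ , unique) = M₀ , agree
    where
    open ≡-Reasoning

    agree-off-x : ∀ M w → S w → w ≢ x → partner M₀ w ≡ partner M w
    agree-off-x M w Sw w≢x = begin
      partner M₀ w                          ≡⟨ sym (proj₂ (extend M₀) w Sw w≢x) ⟩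
      contract (partner N₀ (lift w))        ≡⟨ cong contract (trans (sym (unique N₀ (lift w) S′w))
                                                                    (unique N (lift w) S′w)) ⟩
      contract (partner N (lift w))         ≡⟨ proj₂ (extend M) w Sw w≢x ⟩
      partner M w                           ∎
      where
      N₀ = proj₁ (extend M₀)
      N = proj₁ (extend M)
      S′w = lift-S′ Sw

    agree-at-x : ∀ M → S x → partner M₀ x ≡ partner M x
    agree-at-x M Sx = begin
      q                          ≡⟨ sym (partner-inv M q Sq) ⟩
      partner M (partner M q)    ≡⟨ cong (partner M) (trans (sym (agree-off-x M q Sq (partner-≢ M₀ Sx)))
                                                             (partner-inv M₀ x Sx)) ⟩
      partner M x                ∎
      where
      q = partner M₀ x
      Sq = partner-in M₀ x Sx

    agree : ∀ M w → S w → partner M₀ w ≡ partner M w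
    agree M w Sw with w ≟ x
    ... | yes refl = agree-at-x M Sw
    ... | no w≢x = agree-off-x M w Sw w≢x

lemma1 : ∀ {n : ℕ} (G : Graph n) → IsSimple G → Cubic G → Brick G →
    (x : Fin n) (y : Fin 3 → Fin n) → NeighbourList G x y →
    (u v : Fin n) → G u v ≡ true → ¬ Forcing G u v →
    ¬ Forcing (YΔ G x y) (endpoint x y u v) (endpoint x y v u)
lemma1 G simple _ (_ , bicritical) x y nl u v uv not-forcing forcing =
  not-forcing (extensions-reflect-UniquePM Minus2-lift (edge-extension uv) (bicritical u v u≢v) forcing)
  where
  open YΔ-Properties G simple x y nl
  u≢v : u ≢ v
  u≢v refl = loopless uv
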